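{- Let $\beta$ be a positive integer and let $\varphi_1$ be the CFLS coloring on $V=\{0,1\}^{\beta^2}$. There do not exist five distinct vertices $a,b,c,d,e\in V$ with $\varphi_1(a,b)=\varphi_1(a,e)=\varphi_1(e,c)$ and $\varphi_1(a,d)=\varphi_1(d,e)=\varphi_1(b,c)$.
   Context: Let $\beta$ be a positive integer and $V=\{0,1\}^{\beta^2}$. For $v\in V$ write $v=(v^{(1)},\ldots,v^{(\beta)})$ where each block $v^{(i)}\in\{0,1\}^\beta$ consists of consecutive bits of $v$. The CFLS coloring of the edges of the complete graph on $V$ is defined, for distinct $x,y\in V$, by \[\varphi_1(x,y)=\big((i,\{x^{(i)},y^{(i)}\}),\, i_1,\ldots,i_\beta\big),\] where $i$ is the first index with $x^{(i)}\neq y^{(i)}$, and for each $k=1,\ldots,\beta$, $i_k=0$ if $x^{(k)}=y^{(k)}$ and otherwise $i_k$ is the first position at which a bit of $x^{(k)}$ differs from the corresponding bit of $y^{(k)}$. -}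

module Defs where

open import Data.Nat using (ℕ; suc)
open import Data.Bool using (Bool)
open import Data.Fin using (Fin; zero; suc)
open import Data.Maybe using (Maybe; just; nothing)
open import Data.Vec using (Vec; []; _∷_; lookup; map)
open import Data.Product using (_×_; _,_)
open import Data.Sum using (_⊎_)
open import Relation.Binary.PropositionalEquality using (_≡_; _≢_)
open import Relation.Nullary using (yes; no)
open import Relation.Binary using (DecidableEquality)
import Data.Vec.Properties
import Data.Bool

firstDiff : {A : Set} → DecidableEquality A → {n : ℕ} → Vec A n → Vec A n → Maybe (Fin n)
firstDiff _≟_ [] [] = nothing
firstDiff _≟_ (a ∷ as) (b ∷ bs) with a ≟ b
... | no _ = just zero
... | yes _ with firstDiff _≟_ as bs
...   | just i = just (suc i)
...   | nothing = nothing

Block : ℕ → Set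
Block β = Vec Bool β

-- V = {0,1}^{β²}, stored as its β consecutive blocks of β bits each
V : ℕ → Set
V β = Vec (Block β) β

-- unordered pairs {p , q}, represented by an ordered pair up to swapping
UPair : Set → Set
UPair A = A × A

_≈ᵘ_ : {A : Set} → UPair A → UPair A → Set
(p , q) ≈ᵘ (r , s) = ((p ≡ r) × (q ≡ s)) ⊎ ((p ≡ s) × (q ≡ r))

-- Data of the CFLS colour φ₁(x,y):
--   i     : first block index where x,y differ (nothing only if x = y)
--   pair  : the block pair {x^(i), y^(i)} (taken at i; meaningful when i = just _)
--   iks   : (i_1,…,i_β), with nothing encoding 0 and just j encoding position j
record Colour (β : ℕ) : Set where
  constructor colour
  field
    firstBlock : Maybe (Fin β)
    pair       : Maybe (UPair (Block β))
    iks        : Vec (Maybe (Fin β)) β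

φ₁ : {β : ℕ} → V β → V β → Colour β
φ₁ {β} x y = colour i pr (Data.Vec.zipWith (firstDiff Data.Bool._≟_) x y)
  where
  i = firstDiff (Data.Vec.Properties.≡-dec Data.Bool._≟_) x y
  pr : Maybe (UPair (Block β))
  pr with i
  ... | just k = just (lookup x k , lookup y k)
  ... | nothing = nothing

_≈ᶜ_ : {β : ℕ} → Colour β → Colour β → Set
colour i p v ≈ᶜ colour j q w = (i ≡ j) × PairEq p q × (v ≡ w)
  where
  PairEq : {A : Set} → Maybe (UPair A) → Maybe (UPair A) → Set
  PairEq (just a) (just b) = a ≈ᵘ b
  PairEq a b = a ≡ b

-- Only the vector (i_1, …, i_β) of the colour is needed.  Blockwise, it says that
-- the first-difference positions satisfy δ(a,b) = δ(a,e) = δ(e,c) and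
-- δ(a,d) = δ(d,e) = δ(b,c) in every block.  If two blocks of a and e first differed
-- at position i, then b and c would agree with a before i, with b_i = e_i ≠ a_i = c_i,
-- so δ(b,c) = i; hence δ(a,d) = δ(d,e) = i, and the bits a_i, d_i, e_i would be
-- pairwise distinct.  So every block of a equals that of e, and a = e; only the
-- hypothesis a ≠ e is used.
module Submission where

open import Defs
open import Data.Nat using (ℕ; _>_)
open import Data.Bool using (Bool)
open import Data.Bool.Properties using (¬-not; not-injective)
import Data.Bool
open import Data.Fin using (Fin; zero; suc)
open import Data.Maybe using (Maybe; just; nothing; map)
open import Data.Vec using (Vec; []; _∷_; zipWith)
open import Data.Vec.Properties using (∷-injectiveˡ; ∷-injectiveʳ)
open import Data.Product using (_×_; _,_; ∃)
open import Relation.Nullary using (¬_; yes; no; contradiction)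
open import Relation.Nullary.Decidable using (decidable-stable)
open import Relation.Binary using (DecidableEquality)
open import Relation.Binary.PropositionalEquality
  using (_≡_; _≢_; refl; sym; trans; cong₂)

≢-≢⇒≡ : ∀ {x y z : Bool} → x ≢ y → x ≢ z → y ≡ z
≢-≢⇒≡ x≢y x≢z = not-injective (trans (sym (¬-not x≢y)) (¬-not x≢z))

map-suc-injective : ∀ {n} {m m′ : Maybe (Fin n)} → map suc m ≡ map suc m′ → m ≡ m′
map-suc-injective {m = just _}  {just _}  refl = refl
map-suc-injective {m = nothing} {nothing} refl = refl

map-suc≢just-zero : ∀ {n} (m : Maybe (Fin n)) → map suc m ≢ just zero
map-suc≢just-zero (just _) ()
map-suc≢just-zero nothing  ()

module FirstDiff {A : Set} (_≟_ : DecidableEquality A) where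

  δ : ∀ {n} → Vec A n → Vec A n → Maybe (Fin n)
  δ = firstDiff _≟_

  δ-∷-≡ : ∀ {n x y} (xs ys : Vec A n) → x ≡ y → δ (x ∷ xs) (y ∷ ys) ≡ map suc (δ xs ys)
  δ-∷-≡ {x = x} {y} xs ys x≡y with x ≟ y
  ... | no x≢y = contradiction x≡y x≢y
  ... | yes _ with δ xs ys
  ...   | just _  = refl
  ...   | nothing = refl

  δ-∷-≢ : ∀ {n x y} (xs ys : Vec A n) → x ≢ y → δ (x ∷ xs) (y ∷ ys) ≡ just zero
  δ-∷-≢ {x = x} {y} xs ys x≢y with x ≟ y
  ... | no _    = refl
  ... | yes x≡y = contradiction x≡y x≢y

  ≡⇒δ-∷≢just-zero : ∀ {n x y} (xs ys : Vec A n) → x ≡ y → δ (x ∷ xs) (y ∷ ys) ≢ just zero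
  ≡⇒δ-∷≢just-zero xs ys x≡y eq = map-suc≢just-zero (δ xs ys) (trans (sym (δ-∷-≡ xs ys x≡y)) eq)

  δ-∷≡just-zero⇒≢ : ∀ {n x y} {xs ys : Vec A n} → δ (x ∷ xs) (y ∷ ys) ≡ just zero → x ≢ y
  δ-∷≡just-zero⇒≢ {xs = xs} {ys} eq x≡y = ≡⇒δ-∷≢just-zero xs ys x≡y eq

  δ-∷≢just-zero⇒≡ : ∀ {n x y} {xs ys : Vec A n} → δ (x ∷ xs) (y ∷ ys) ≢ just zero → x ≡ y
  δ-∷≢just-zero⇒≡ {x = x} {y} {xs} {ys} neq =
    decidable-stable (x ≟ y) (λ x≢y → neq (δ-∷-≢ xs ys x≢y))

  δ-∷-injective : ∀ {n x y u v} {xs ys us vs : Vec A n} → x ≡ y → u ≡ v →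
                  δ (x ∷ xs) (y ∷ ys) ≡ δ (u ∷ us) (v ∷ vs) → δ xs ys ≡ δ us vs
  δ-∷-injective {xs = xs} {ys} {us} {vs} x≡y u≡v eq =
    map-suc-injective (trans (sym (δ-∷-≡ xs ys x≡y)) (trans eq (δ-∷-≡ us vs u≡v)))

open FirstDiff Data.Bool._≟_

δ-pattern⇒≡ : ∀ {n} (a b c d e : Vec Bool n) →
              δ a b ≡ δ a e → δ a e ≡ δ e c → δ a d ≡ δ d e → δ d e ≡ δ b c → a ≡ e
δ-pattern⇒≡ [] [] [] [] [] _ _ _ _ = refl
δ-pattern⇒≡ (a ∷ as) (b ∷ bs) (c ∷ cs) (d ∷ ds) (e ∷ es) ab≡ae ae≡ec ad≡de de≡bc =
  cong₂ _∷_ a≡e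
    (δ-pattern⇒≡ as bs cs ds es
      (δ-∷-injective a≡b a≡e ab≡ae) (δ-∷-injective a≡e e≡c ae≡ec)
      (δ-∷-injective a≡d d≡e ad≡de) (δ-∷-injective d≡e b≡c de≡bc))
  where
  a≢e-impossible : ¬ a ≢ e
  a≢e-impossible a≢e = d≢e (≢-≢⇒≡ a≢d a≢e)
    where
    ae-first : δ (a ∷ as) (e ∷ es) ≡ just zero
    ae-first = δ-∷-≢ as es a≢e
    b≡e : b ≡ e
    b≡e = ≢-≢⇒≡ (δ-∷≡just-zero⇒≢ (trans ab≡ae ae-first)) a≢e
    b≢c : b ≢ c
    b≢c b≡c = δ-∷≡just-zero⇒≢ (trans (sym ae≡ec) ae-first) (trans (sym b≡e) b≡c)
    de-first : δ (d ∷ ds) (e ∷ es) ≡ just zero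
    de-first = trans de≡bc (δ-∷-≢ bs cs b≢c)
    d≢e : d ≢ e
    d≢e = δ-∷≡just-zero⇒≢ de-first
    a≢d : a ≢ d
    a≢d = δ-∷≡just-zero⇒≢ (trans ad≡de de-first)
  a≡e : a ≡ e
  a≡e = decidable-stable (a Data.Bool.≟ e) a≢e-impossible
  ae-later : δ (a ∷ as) (e ∷ es) ≢ just zero
  ae-later = ≡⇒δ-∷≢just-zero as es a≡e
  a≡b : a ≡ b
  a≡b = δ-∷≢just-zero⇒≡ (λ eq → ae-later (trans (sym ab≡ae) eq))
  e≡c : e ≡ c
  e≡c = δ-∷≢just-zero⇒≡ (λ eq → ae-later (trans ae≡ec eq))
  b≡c : b ≡ c
  b≡c = trans (sym a≡b) (trans a≡e e≡c)
  bc-later : δ (b ∷ bs) (c ∷ cs) ≢ just zero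
  bc-later = ≡⇒δ-∷≢just-zero bs cs b≡c
  d≡e : d ≡ e
  d≡e = δ-∷≢just-zero⇒≡ (λ eq → bc-later (trans (sym de≡bc) eq))
  a≡d : a ≡ d
  a≡d = trans a≡e (sym d≡e)

blockwise-δ-pattern⇒≡ : ∀ {β n} (a b c d e : Vec (Vec Bool n) β) →
                        zipWith δ a b ≡ zipWith δ a e → zipWith δ a e ≡ zipWith δ e c →
                        zipWith δ a d ≡ zipWith δ d e → zipWith δ d e ≡ zipWith δ b c → a ≡ e
blockwise-δ-pattern⇒≡ [] [] [] [] [] _ _ _ _ = refl
blockwise-δ-pattern⇒≡ (a ∷ as) (b ∷ bs) (c ∷ cs) (d ∷ ds) (e ∷ es) ab≡ae ae≡ec ad≡de de≡bc =
  cong₂ _∷_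
    (δ-pattern⇒≡ a b c d e (∷-injectiveˡ ab≡ae) (∷-injectiveˡ ae≡ec) (∷-injectiveˡ ad≡de) (∷-injectiveˡ de≡bc))
    (blockwise-δ-pattern⇒≡ as bs cs ds es
      (∷-injectiveʳ ab≡ae) (∷-injectiveʳ ae≡ec) (∷-injectiveʳ ad≡de) (∷-injectiveʳ de≡bc))

mainTheorem6 : (β : ℕ) → β > 0 → ¬ (∃ λ (a : V β) → ∃ λ (b : V β) → ∃ λ (c : V β) → ∃ λ (d : V β) → ∃ λ (e : V β) →
    (a ≢ b) × (a ≢ c) × (a ≢ d) × (a ≢ e) × (b ≢ c) × (b ≢ d) × (b ≢ e) × (c ≢ d) × (c ≢ e) × (d ≢ e) ×
    (φ₁ a b ≈ᶜ φ₁ a e) × (φ₁ a e ≈ᶜ φ₁ e c) ×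
    (φ₁ a d ≈ᶜ φ₁ d e) × (φ₁ d e ≈ᶜ φ₁ b c))
mainTheorem6 β _ (a , b , c , d , e , _ , _ , _ , a≢e , _ , _ , _ , _ , _ , _ ,
                  (_ , _ , ab≡ae) , (_ , _ , ae≡ec) , (_ , _ , ad≡de) , (_ , _ , de≡bc)) =
  a≢e (blockwise-δ-pattern⇒≡ a b c d e ab≡ae ae≡ec ad≡de de≡bc)
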